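{- Suppose that $f:\mathbb{N}\to\mathbb{C}$ is a multiplicative function which for all sufficiently large $n$ is given by $f(n)=n^k\chi(n)$, where $k$ is a natural number and $\chi:\mathbb{N}\to\mathbb{C}$ is a periodic multiplicative function that is not identically $0$. Then $f(n)=n^k\chi(n)$ for all $n\in\mathbb{N}$.
   Context: $\mathbb{N}=\{1,2,3,\ldots\}$. A function $f$ on $\mathbb{N}$ is multiplicative if $f(mn)=f(m)f(n)$ whenever $\gcd(m,n)=1$. A function $\chi$ is periodic if there is $d\in\mathbb{N}$ with $\chi(n+d)=\chi(n)$ for all $n$. -}

module Defs where

open import Level using (Level)
open import Algebra.Bundles using (CommutativeRing)
open import Data.Nat using (ℕ; zero; suc; _≤_) renaming (_+_ to _+ℕ_; _*_ to _*ℕ_)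
open import Data.Nat.Coprimality using (Coprime)
open import Data.Product using (Σ; _×_)
open import Data.Sum using (_⊎_)
open import Relation.Nullary using (¬_)

module _ {c ℓ : Level} (R : CommutativeRing c ℓ) where
  open CommutativeRing R

  ι : ℕ → Carrier
  ι zero    = 0#
  ι (suc n) = 1# + ι n

  NoZeroDivisors : Set (c Level.⊔ ℓ)
  NoZeroDivisors = ∀ x y → x * y ≈ 0# → x ≈ 0# ⊎ y ≈ 0#

  CharZero : Set ℓ
  CharZero = ∀ n → ¬ (ι (suc n) ≈ 0#)

  -- functions on ℕ = {1,2,3,...}; the value at 0 is ignored
  Multiplicative : (ℕ → Carrier) → Set ℓ
  Multiplicative f = ∀ m n → 1 ≤ m → 1 ≤ n → Coprime m n → f (m *ℕ n) ≈ f m * f n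

  Periodic : (ℕ → Carrier) → Set ℓ
  Periodic χ = Σ ℕ λ d → 1 ≤ d × (∀ n → 1 ≤ n → χ (n +ℕ d) ≈ χ n)

  IdenticallyZero : (ℕ → Carrier) → Set ℓ
  IdenticallyZero χ = ∀ n → 1 ≤ n → χ n ≈ 0#

{-# OPTIONS --safe #-}
-- For n ≥ 1 take m = 1 + N n d, where d is a period of χ: then m ≥ N, m is
-- coprime to n and χ m = χ 1. Evaluating f (n m) once by multiplicativity and
-- once by the formula gives f n · m^k χ 1 = n^k χ n · m^k χ 1, and m^k χ 1 can
-- be cancelled: m^k ≠ 0 in characteristic zero, and χ 1 = 0 would force
-- χ a = χ a · χ 1 = 0 for every a.
module Submission where

open import Defs
open import Level using (Level)
open import Algebra.Bundles using (CommutativeRing)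
open import Data.Nat using (ℕ; zero; suc; s≤s; z≤n; _≤_; _^_; NonZero; >-nonZero) renaming (_+_ to _+ℕ_; _*_ to _*ℕ_)
import Data.Nat.Properties as ℕ
open import Data.Nat.Divisibility using (_∣_; ∣m+n∣m⇒∣n; ∣1⇒≡1; ∣-trans; n∣m*n*o)
open import Data.Nat.Coprimality as Coprime using (Coprime; 1-coprimeTo)
open import Data.Product using (Σ; _,_)
open import Data.Sum using (inj₁; inj₂)
open import Relation.Nullary using (¬_; contradiction)
open import Relation.Binary.PropositionalEquality as ≡ using (_≡_; cong; module ≡-Reasoning)
import Algebra.Properties.Ring as RingProperties
import Algebra.Properties.Group as GroupProperties
import Algebra.Properties.CommutativeSemigroup as CommutativeSemigroupProperties
import Algebra.Properties.Semiring.Mult as SemiringMult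

^-distrib-* : ∀ a b k → (a *ℕ b) ^ k ≡ a ^ k *ℕ b ^ k
^-distrib-* a b zero    = ≡.refl
^-distrib-* a b (suc k) = begin
  a *ℕ b *ℕ (a *ℕ b) ^ k        ≡⟨ cong (a *ℕ b *ℕ_) (^-distrib-* a b k) ⟩
  a *ℕ b *ℕ (a ^ k *ℕ b ^ k)    ≡⟨ ℕ.*-assoc a b _ ⟩
  a *ℕ (b *ℕ (a ^ k *ℕ b ^ k))  ≡⟨ cong (a *ℕ_) (ℕ.*-comm b _) ⟩
  a *ℕ (a ^ k *ℕ b ^ k *ℕ b)    ≡⟨ cong (a *ℕ_) (ℕ.*-assoc (a ^ k) _ _) ⟩
  a *ℕ (a ^ k *ℕ (b ^ k *ℕ b))  ≡⟨ ℕ.*-assoc a _ _ ⟨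
  a *ℕ a ^ k *ℕ (b ^ k *ℕ b)    ≡⟨ cong (a *ℕ a ^ k *ℕ_) (ℕ.*-comm (b ^ k) b) ⟩
  a *ℕ a ^ k *ℕ (b *ℕ b ^ k)    ∎
  where open ≡-Reasoning

coprime-1+ : ∀ {a n} → n ∣ a → Coprime (suc a) n
coprime-1+ {a} n∣a {k} (k∣1+a , k∣n) =
  ∣1⇒≡1 (∣m+n∣m⇒∣n (≡.subst (k ∣_) (ℕ.+-comm 1 a) k∣1+a) (∣-trans k∣n n∣a))

module _ {c ℓ : Level} (R : CommutativeRing c ℓ) where
  open CommutativeRing R
  open SemiringMult semiring using (_×_; ×1-homo-*)
  open import Relation.Binary.Reasoning.Setoid setoid

  ι≈×1# : ∀ n → ι R n ≈ n × 1#
  ι≈×1# zero    = refl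
  ι≈×1# (suc n) = +-congˡ (ι≈×1# n)

  ι-homo-* : ∀ m n → ι R (m *ℕ n) ≈ ι R m * ι R n
  ι-homo-* m n = begin
    ι R (m *ℕ n)          ≈⟨ ι≈×1# (m *ℕ n) ⟩
    (m *ℕ n) × 1#         ≈⟨ ×1-homo-* m n ⟩
    (m × 1#) * (n × 1#)   ≈⟨ *-cong (ι≈×1# m) (ι≈×1# n) ⟨
    ι R m * ι R n         ∎

  ι-^-distrib-* : ∀ m n k → ι R ((m *ℕ n) ^ k) ≈ ι R (m ^ k) * ι R (n ^ k)
  ι-^-distrib-* m n k = trans (reflexive (cong (ι R) (^-distrib-* m n k))) (ι-homo-* (m ^ k) (n ^ k))

  ι-nonZero : CharZero R → ∀ n → .{{NonZero n}} → ¬ ι R n ≈ 0#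
  ι-nonZero charZero (suc n) = charZero n

  module _ (noZeroDivisors : NoZeroDivisors R) where
    open RingProperties ring using ([y-z]x≈yx-zx)
    open GroupProperties +-group using (x∙y⁻¹≈ε⇒x≈y; x≈y⇒x∙y⁻¹≈ε)

    *-nonZero : ∀ {x y} → ¬ x ≈ 0# → ¬ y ≈ 0# → ¬ x * y ≈ 0#
    *-nonZero x≉0 y≉0 xy≈0 with noZeroDivisors _ _ xy≈0
    ... | inj₁ x≈0 = x≉0 x≈0
    ... | inj₂ y≈0 = y≉0 y≈0

    *-cancelʳ-nonZero : ∀ {z} x y → ¬ z ≈ 0# → x * z ≈ y * z → x ≈ y
    *-cancelʳ-nonZero {z} x y z≉0 xz≈yz
      with noZeroDivisors (x - y) z (trans ([y-z]x≈yx-zx z x y) (x≈y⇒x∙y⁻¹≈ε xz≈yz))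
    ... | inj₁ x-y≈0 = x∙y⁻¹≈ε⇒x≈y x y x-y≈0
    ... | inj₂ z≈0   = contradiction z≈0 z≉0

  module _ {χ : ℕ → Carrier} where

    periodic-multiple : ∀ {d} → (∀ n → 1 ≤ n → χ (n +ℕ d) ≈ χ n) →
                        ∀ n q → 1 ≤ n → χ (n +ℕ q *ℕ d) ≈ χ n
    periodic-multiple period n zero    1≤n = reflexive (cong χ (ℕ.+-identityʳ n))
    periodic-multiple {d} period n (suc q) 1≤n = begin
      χ (n +ℕ (d +ℕ q *ℕ d))  ≈⟨ reflexive (cong χ (reorder n d (q *ℕ d))) ⟩
      χ (n +ℕ q *ℕ d +ℕ d)    ≈⟨ period _ (ℕ.≤-trans 1≤n (ℕ.m≤m+n n _)) ⟩
      χ (n +ℕ q *ℕ d)         ≈⟨ periodic-multiple period n q 1≤n ⟩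
      χ n                     ∎
      where
      reorder : ∀ a b c → a +ℕ (b +ℕ c) ≡ a +ℕ c +ℕ b
      reorder a b c = ≡.trans (cong (a +ℕ_) (ℕ.+-comm b c)) (≡.sym (ℕ.+-assoc a c b))

    χ1-nonZero : Multiplicative R χ → ¬ IdenticallyZero R χ → ¬ χ 1 ≈ 0#
    χ1-nonZero multiplicative χ≢0 χ1≈0 = χ≢0 λ a 1≤a → begin
      χ a          ≈⟨ reflexive (cong χ (ℕ.*-identityʳ a)) ⟨
      χ (a *ℕ 1)   ≈⟨ multiplicative a 1 1≤a (s≤s z≤n) (Coprime.sym (1-coprimeTo a)) ⟩
      χ a * χ 1    ≈⟨ *-congˡ χ1≈0 ⟩
      χ a * 0#     ≈⟨ zeroʳ (χ a) ⟩
      0#           ∎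

lemma2p3 : {c ℓ : Level} (R : CommutativeRing c ℓ) →
    NoZeroDivisors R → CharZero R →
    (f χ : ℕ → CommutativeRing.Carrier R) (k : ℕ) →
    Multiplicative R f →
    Multiplicative R χ → Periodic R χ → ¬ IdenticallyZero R χ →
    Σ ℕ (λ N → (n : ℕ) → N ≤ n →
      CommutativeRing._≈_ R (f n) (CommutativeRing._*_ R (ι R (n ^ k)) (χ n))) →
    (n : ℕ) → 1 ≤ n →
      CommutativeRing._≈_ R (f n) (CommutativeRing._*_ R (ι R (n ^ k)) (χ n))
lemma2p3 R noZeroDivisors charZero f χ k f-mult χ-mult (d , 1≤d , period) χ≢0 (N , f≈) n 1≤n =
  *-cancelʳ-nonZero R noZeroDivisors (f n) (ι R (n ^ k) * χ n) cₘ≉0 (begin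
    f n * cₘ                                     ≈⟨ *-congˡ (f≈ m N≤m) ⟨
    f n * f m                                    ≈⟨ f-mult n m 1≤n 1≤m n⊥m ⟨
    f (n *ℕ m)                                   ≈⟨ f≈ (n *ℕ m) N≤nm ⟩
    ι R ((n *ℕ m) ^ k) * χ (n *ℕ m)              ≈⟨ *-cong (ι-^-distrib-* R n m k) (χ-mult n m 1≤n 1≤m n⊥m) ⟩
    ι R (n ^ k) * ι R (m ^ k) * (χ n * χ m)      ≈⟨ interchange _ _ _ _ ⟩
    ι R (n ^ k) * χ n * cₘ                       ∎)
  where
  open CommutativeRing R
  open CommutativeSemigroupProperties *-commutativeSemigroup using (interchange)
  open import Relation.Binary.Reasoning.Setoid setoid
  instance
    _ : NonZero n
    _ = >-nonZero 1≤n
    _ : NonZero d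
    _ = >-nonZero 1≤d

  m : ℕ
  m = suc (N *ℕ n *ℕ d)

  1≤m : 1 ≤ m
  1≤m = s≤s z≤n

  N≤m : N ≤ m
  N≤m = ℕ.≤-trans (ℕ.m≤m*n N n) (ℕ.≤-trans (ℕ.m≤m*n (N *ℕ n) d) (ℕ.n≤1+n _))

  N≤nm : N ≤ n *ℕ m
  N≤nm = ℕ.≤-trans N≤m (ℕ.m≤n*m m n)

  n⊥m : Coprime n m
  n⊥m = Coprime.sym (coprime-1+ (n∣m*n*o N d))

  cₘ : Carrier
  cₘ = ι R (m ^ k) * χ m

  cₘ≉0 : ¬ cₘ ≈ 0#
  cₘ≉0 = *-nonZero R noZeroDivisors (ι-nonZero R charZero (m ^ k) {{ℕ.m^n≢0 m k}}) χm≉0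
    where
    χm≉0 : ¬ χ m ≈ 0#
    χm≉0 χm≈0 = χ1-nonZero R χ-mult χ≢0
      (trans (sym (periodic-multiple R period 1 (N *ℕ n) ℕ.≤-refl)) χm≈0)
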